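{- Let $G$ be a graph and let $e\in E(G)$. If $S_e$ is the equivalence class of $e$ under $\mathcal{C}_G$, then the graph $G[S_e]$ is not properly quasi-transitively colourable.
   Context: A quasi-transitive $2$-edge-colouring of a graph $G$ is a map $c: E(G)\to\{R,B\}$ such that for all pairs of edges $xy, yz \in E(G)$ with $c(xy)\neq c(yz)$, we have $xz\in E(G)$; it is trivial if it is constant on $E(G)$, and a graph is properly quasi-transitively colourable if it admits a nontrivial one. $\mathcal{C}_G$ is the equivalence relation on $E(G)$ with $e\sim f$ iff $c(e)=c(f)$ for every quasi-transitive $2$-edge-colouring $c$ of $G$. For a set of edges $E$, $G[E]$ is the graph with edge set $E$ and vertex set the set of endpoints of edges in $E$. -}

module Defs where

open import Data.Nat using (ℕ)
open import Data.Fin using (Fin)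
open import Data.Bool using (Bool; true; false)
open import Data.Product using (Σ; _×_)
open import Relation.Nullary using (¬_)
open import Relation.Binary.PropositionalEquality using (_≡_; _≢_)

record Graph (n : ℕ) : Set where
  field
    adj    : Fin n → Fin n → Bool
    sym    : ∀ x y → adj x y ≡ adj y x
    irrefl : ∀ x → adj x x ≡ false

open Graph public

EdgeRel : ℕ → Set₁
EdgeRel n = Fin n → Fin n → Set

Edge : ∀ {n} → Graph n → EdgeRel n
Edge G x y = adj G x y ≡ true

data Colour : Set where
  R B : Colour

-- A 2-edge-colouring, given by a colour for every ordered pair, required to be
-- symmetric on edges (so it is a map from the unordered edges to {R,B}).
Colouring : ℕ → Set
Colouring n = Fin n → Fin n → Colour

IsEdgeColouring : ∀ {n} → EdgeRel n → Colouring n → Set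
IsEdgeColouring E c = ∀ x y → E x y → c x y ≡ c y x

QuasiTransitive : ∀ {n} → EdgeRel n → Colouring n → Set
QuasiTransitive E c =
  IsEdgeColouring E c ×
  (∀ x y z → E x y → E y z → c x y ≢ c y z → E x z)

Trivial : ∀ {n} → EdgeRel n → Colouring n → Set
Trivial E c = ∀ x y u v → E x y → E u v → c x y ≡ c u v

ProperlyQTColourable : ∀ {n} → EdgeRel n → Set
ProperlyQTColourable {n} E =
  Σ (Colouring n) (λ c → QuasiTransitive E c × ¬ Trivial E c)

CG : ∀ {n} → Graph n → Fin n → Fin n → Fin n → Fin n → Set
CG {n} G x y u v = ∀ (c : Colouring n) → QuasiTransitive (Edge G) c → c x y ≡ c u v

-- Edge relation of G[S_e] for e = uv: the edges of G equivalent to uv under 𝒞_G.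
-- (Vertices not incident to such edges are isolated and do not affect colourings.)
SubEdges : ∀ {n} → Graph n → Fin n → Fin n → EdgeRel n
SubEdges G u v x y = Edge G x y × CG G x y u v

-- Given a quasi-transitive colouring c of G[S_e], colour the edges of S_e by c
-- and all other edges of G red. A 2-path xy, yz of G that does not span a
-- triangle has its two edges coloured alike by every quasi-transitive
-- colouring, i.e. xy ~ yz; so a 2-path with exactly one edge in S_e spans a
-- triangle, and the extension is quasi-transitive on G. By the definition of
-- S_e the extension is then constant on S_e, hence so is c.
-- Membership in S_e is not decidable constructively, but the claim is a
-- negation, so we may decide it for the finitely many vertex pairs.
module Submission where

open import Defs hiding (sym)
open import Data.Nat using (ℕ)
open import Data.Fin using (Fin)
open import Data.Fin.Properties using (sequence)
open import Data.Bool using (true)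
import Data.Bool.Properties as Bool
open import Data.Product using (_,_; proj₁; proj₂)
open import Effect.Monad using (RawMonad)
open import Relation.Nullary using (¬_; Dec; yes; no; contradiction)
open import Relation.Nullary.Decidable using (decidable-stable; ¬¬-excluded-middle)
open import Relation.Nullary.Negation using (¬¬-Monad)
open import Relation.Binary.Definitions using (DecidableEquality)
open import Relation.Binary.PropositionalEquality using (_≡_; _≢_; refl; sym; trans; module ≡-Reasoning)

_≟ᶜ_ : DecidableEquality Colour
R ≟ᶜ R = yes refl
R ≟ᶜ B = no λ ()
B ≟ᶜ R = no λ ()
B ≟ᶜ B = yes refl

¬¬-decide₂ : ∀ {n} (P : Fin n → Fin n → Set) → ¬ ¬ (∀ x y → Dec (P x y))
¬¬-decide₂ P = sequence rawApplicative λ x → sequence rawApplicative λ y → ¬¬-excluded-middle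
  where open RawMonad ¬¬-Monad

module _ {n : ℕ} (G : Graph n) where

  Edge-sym : ∀ {x y} → Edge G x y → Edge G y x
  Edge-sym {x} {y} exy = trans (Graph.sym G y x) exy

  CG-swap : ∀ {x y a b} → Edge G x y → CG G x y a b → CG G y x a b
  CG-swap exy xy~ab c qt = trans (sym (proj₁ qt _ _ exy)) (xy~ab c qt)

  CG-induced-path : ∀ {x y z} → Edge G x y → Edge G y z → ¬ Edge G x z → CG G x y y z
  CG-induced-path {x} {y} {z} exy eyz ¬exz c (_ , closed) =
    decidable-stable (c x y ≟ᶜ c y z) λ c≢ → ¬exz (closed x y z exy eyz c≢)

  inequivalent-path-closes : ∀ {x y z a b} → Edge G x y → Edge G y z →
    CG G x y a b → ¬ CG G y z a b → Edge G x z
  inequivalent-path-closes {x} {z = z} exy eyz xy~ab ¬yz~ab =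
    decidable-stable (adj G x z Bool.≟ true) λ ¬exz →
      ¬yz~ab λ c qt → trans (sym (CG-induced-path exy eyz ¬exz c qt)) (xy~ab c qt)

  module Extension (u v : Fin n) (S? : ∀ x y → Dec (CG G x y u v))
    (c : Colouring n) (qt : QuasiTransitive (SubEdges G u v) c) where

    extend : Colouring n
    extend x y with S? x y
    ... | yes _ = c x y
    ... | no  _ = R

    extend-inside : ∀ {x y} → CG G x y u v → extend x y ≡ c x y
    extend-inside {x} {y} xy∈S with S? x y
    ... | yes _    = refl
    ... | no xy∉S = contradiction xy∈S xy∉S

    extend-outside : ∀ {x y} → ¬ CG G x y u v → extend x y ≡ R
    extend-outside {x} {y} xy∉S with S? x y
    ... | yes xy∈S = contradiction xy∈S xy∉S
    ... | no _     = refl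

    extend-symmetric : IsEdgeColouring (Edge G) extend
    extend-symmetric x y exy with S? x y
    ... | yes xy∈S = trans (proj₁ qt x y (exy , xy∈S)) (sym (extend-inside (CG-swap exy xy∈S)))
    ... | no xy∉S  = sym (extend-outside λ yx∈S → xy∉S (CG-swap (Edge-sym exy) yx∈S))

    extend-quasiTransitive : QuasiTransitive (Edge G) extend
    extend-quasiTransitive = extend-symmetric , closed
      where
      closed : ∀ x y z → Edge G x y → Edge G y z → extend x y ≢ extend y z → Edge G x z
      closed x y z exy eyz c≢ with S? x y | S? y z
      ... | yes xy∈S | yes yz∈S = proj₁ (proj₂ qt x y z (exy , xy∈S) (eyz , yz∈S) c≢)
      ... | yes xy∈S | no yz∉S  = inequivalent-path-closes exy eyz xy∈S yz∉S
      ... | no xy∉S  | yes yz∈S = Edge-sym (inequivalent-path-closes (Edge-sym eyz) (Edge-sym exy)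
                                    (CG-swap eyz yz∈S) λ yx∈S → xy∉S (CG-swap (Edge-sym exy) yx∈S))
      ... | no _     | no _     = contradiction refl c≢

    restriction-trivial : Trivial (SubEdges G u v) c
    restriction-trivial x y a b (_ , xy∈S) (_ , ab∈S) = begin
      c x y       ≡⟨ sym (extend-inside xy∈S) ⟩
      extend x y  ≡⟨ xy∈S extend extend-quasiTransitive ⟩
      extend u v  ≡⟨ sym (ab∈S extend extend-quasiTransitive) ⟩
      extend a b  ≡⟨ extend-inside ab∈S ⟩
      c a b       ∎
      where open ≡-Reasoning

theorem18 : ∀ {n : ℕ} (G : Graph n) (u v : Fin n) → Edge G u v →
    ¬ ProperlyQTColourable (SubEdges G u v)
theorem18 G u v _ (c , qt , nontrivial) =
  ¬¬-decide₂ (λ x y → CG G x y u v) λ S? →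
    nontrivial (Extension.restriction-trivial G u v S? c qt)
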